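{- Let $S$ be a numerical semigroup with $S\neq \mathbb{N}$ and let $k$ be a positive integer. Then $\mathrm{C}(S)=k$ if and only if $(k-1)\,\mathrm{m}(S)<\mathrm{F}(S)<k\,\mathrm{m}(S)$.
   Context: A numerical semigroup is a subset $S\subseteq\mathbb{N}=\{0,1,2,\dots\}$ containing $0$, closed under addition, with $\mathbb{N}\setminus S$ finite. $\mathrm{F}(S)=\max(\mathbb{Z}\setminus S)$ (Frobenius number) and $\mathrm{m}(S)=\min(S\setminus\{0\})$ (multiplicity). For a numerical semigroup $\Delta$, an ideal of $\Delta$ is a nonempty $I\subseteq\Delta$ with $I+\Delta\subseteq I$. $\mathcal{J}(\Delta)$ is the set of numerical semigroups $S$ such that $S\setminus\{0\}$ is an ideal of $\Delta$; for a family $\mathscr{F}$ of numerical semigroups, $\mathcal{J}(\mathscr{F})=\bigcup_{\Delta\in\mathscr{F}}\mathcal{J}(\Delta)$. Set $\mathcal{J}^0(\mathbb{N})=\{\mathbb{N}\}$, $\mathcal{J}^1(\mathbb{N})=\mathcal{J}(\mathbb{N})$ and $\mathcal{J}^{k+1}(\mathbb{N})=\mathcal{J}(\mathcal{J}^k(\mathbb{N}))$. The complexity of a numerical semigroup $S$ is $\mathrm{C}(S)=\min\{k\in\mathbb{N}\mid S\in\mathcal{J}^k(\mathbb{N})\}$ (this set is nonempty for every numerical semigroup). -}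

module Defs where

open import Data.Nat using (ℕ; zero; suc; _+_; _<_; _≤_)
open import Data.Product using (Σ; ∃; _×_)
open import Relation.Nullary using (¬_)
open import Relation.Binary.PropositionalEquality using (_≡_)

SubsetN : Set₁
SubsetN = ℕ → Set

record IsNumericalSemigroup (S : SubsetN) : Set where
  field
    has-zero : S 0
    closed   : ∀ a b → S a → S b → S (a + b)
    cofinite : ∃ λ N → ∀ n → N ≤ n → S n

-- f is the Frobenius number of S (S ≠ ℕ, so F(S) is a natural number):
-- f ∉ S and every integer > f lies in S.
IsFrobenius : SubsetN → ℕ → Set
IsFrobenius S f = ¬ S f × (∀ n → f < n → S n)

IsMultiplicity : SubsetN → ℕ → Set
IsMultiplicity S m = 0 < m × S m × (∀ n → 0 < n → n < m → ¬ S n)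

IsIdealMinusZero : (Δ S : SubsetN) → Set
IsIdealMinusZero Δ S =
  (∃ λ a → S a × ¬ a ≡ 0)
  × (∀ a → S a → ¬ a ≡ 0 → Δ a)
  × (∀ a b → S a → ¬ a ≡ 0 → Δ b → S (a + b) × ¬ (a + b) ≡ 0)

data InJ : ℕ → SubsetN → Set₁ where
  base : ∀ {S} → (∀ n → S n) → InJ 0 S
  step : ∀ {k Δ S} → InJ k Δ → IsNumericalSemigroup S
       → IsIdealMinusZero Δ S → InJ (suc k) S

HasComplexity : SubsetN → ℕ → Set₁
HasComplexity S k = InJ k S × (∀ j → j < k → ¬ InJ j S)

{-# OPTIONS --safe #-}
module Submission where

open import Defs
open import Data.Nat using (ℕ; _<_; _*_; _∸_)
open import Data.Product using (∃; _×_)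
open import Relation.Nullary using (¬_)
open import Function.Bundles using (_⇔_)

open import Data.Nat using (zero; suc; _+_; _≤_; z≤n; _≤?_)
open import Data.Nat.Properties
open import Data.Product using (_,_; proj₁)
open import Data.Sum using (_⊎_; inj₁; inj₂)
open import Relation.Nullary using (yes; no; contradiction)
open import Relation.Binary.PropositionalEquality using (_≢_; ≢-sym; subst)
open import Function.Base using (_∘_)
open import Function.Bundles using (mk⇔; module Equivalence)

-- A semigroup of complexity k contains every n ≥ k·a for each nonzero a in it:
-- if S ∖ {0} is an ideal of Δ, then a + (Δ ∩ [(k-1)·a, ∞)) ⊆ S.
-- Conversely, when F(S) < k·m, the chain S ⊆ S ∪ [(k-1)·m, ∞) ⊆ … ⊆ S ∪ [0, ∞) = ℕ
-- witnesses S ∈ J^k(ℕ): each S ∖ {0} is an ideal of the next set, since adding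
-- an element ≥ m to a number ≥ (j-1)·m lands in [j·m, ∞).  The theorem follows
-- because f is not a multiple of m, so "S ∈ J^k ⇔ f < k·m" pins down C(S).

_∪≥_ : SubsetN → ℕ → SubsetN
(S ∪≥ c) n = S n ⊎ c ≤ n

multiplicity-≤ : ∀ {S m s} → IsMultiplicity S m → S s → s ≢ 0 → m ≤ s
multiplicity-≤ {m = m} {s} (_ , _ , below) ss s≢0 with m ≤? s
... | yes m≤s = m≤s
... | no m≰s = contradiction ss (below s (n≢0⇒n>0 s≢0) (≰⇒> m≰s))

multiple-∈ : ∀ {S a} → IsNumericalSemigroup S → S a → ∀ j → S (j * a)
multiple-∈ ns sa zero = IsNumericalSemigroup.has-zero ns
multiple-∈ {a = a} ns sa (suc j) =
  IsNumericalSemigroup.closed ns a (j * a) sa (multiple-∈ ns sa j)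

∪≥-isNumericalSemigroup : ∀ {S} c → IsNumericalSemigroup S → IsNumericalSemigroup (S ∪≥ c)
∪≥-isNumericalSemigroup {S} c ns = record
  { has-zero = inj₁ (IsNumericalSemigroup.has-zero ns)
  ; closed   = closed
  ; cofinite = c , λ _ → inj₂
  }
  where
  closed : ∀ a b → (S ∪≥ c) a → (S ∪≥ c) b → (S ∪≥ c) (a + b)
  closed a b (inj₁ sa) (inj₁ sb) = inj₁ (IsNumericalSemigroup.closed ns a b sa sb)
  closed a b (inj₁ _)  (inj₂ c≤b) = inj₂ (≤-trans c≤b (m≤n+m b a))
  closed a b (inj₂ c≤a) _         = inj₂ (≤-trans c≤a (m≤m+n a b))

∪≥-isMultiplicity : ∀ {S m c} → m ≤ c → IsMultiplicity S m → IsMultiplicity (S ∪≥ c) m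
∪≥-isMultiplicity {S} {m} {c} m≤c (0<m , sm , below) = 0<m , inj₁ sm , below′
  where
  below′ : ∀ n → 0 < n → n < m → ¬ (S ∪≥ c) n
  below′ n 0<n n<m (inj₁ sn)  = below n 0<n n<m sn
  below′ n 0<n n<m (inj₂ c≤n) = <⇒≱ n<m (≤-trans m≤c c≤n)

minusZero-isIdeal-∪≥ : ∀ {S m} c → IsNumericalSemigroup S → IsMultiplicity S m
  → (∀ n → m + c ≤ n → S n) → IsIdealMinusZero (S ∪≥ c) S
minusZero-isIdeal-∪≥ {S} {m} c ns mult@(0<m , m∈S , _) tail =
  (m , m∈S , ≢-sym (<⇒≢ 0<m)) , (λ _ sa _ → inj₁ sa) , absorbs
  where
  absorbs : ∀ a b → S a → a ≢ 0 → (S ∪≥ c) b → S (a + b) × a + b ≢ 0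
  absorbs a b sa a≢0 Δb = absorb Δb , a≢0 ∘ m+n≡0⇒m≡0 a
    where
    absorb : (S ∪≥ c) b → S (a + b)
    absorb (inj₁ sb)  = IsNumericalSemigroup.closed ns a b sa sb
    absorb (inj₂ c≤b) = tail (a + b) (+-mono-≤ (multiplicity-≤ mult sa a≢0) c≤b)

InJ⇒tail : ∀ {k S a} → InJ k S → S a → a ≢ 0 → ∀ n → k * a ≤ n → S n
InJ⇒tail (base all) _ _ n _ = all n
InJ⇒tail {suc k} {S} {a} (step {Δ = Δ} Δ∈J _ (_ , S⊆Δ , absorbs)) sa a≢0 n a+ka≤n =
  subst S (m+[n∸m]≡n a≤n) (proj₁ (absorbs a (n ∸ a) sa a≢0 Δ[n∸a]))
  where
  a≤n : a ≤ n
  a≤n = ≤-trans (m≤m+n a (k * a)) a+ka≤n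
  ka≤n∸a : k * a ≤ n ∸ a
  ka≤n∸a = subst (_≤ n ∸ a) (m+n∸m≡n a (k * a)) (∸-monoˡ-≤ a a+ka≤n)
  Δ[n∸a] : Δ (n ∸ a)
  Δ[n∸a] = InJ⇒tail Δ∈J (S⊆Δ a sa a≢0) a≢0 (n ∸ a) ka≤n∸a

tail⇒InJ : ∀ k {S m} → IsNumericalSemigroup S → IsMultiplicity S m
  → (∀ n → k * m ≤ n → S n) → InJ k S
tail⇒InJ zero ns _ tail = base (λ n → tail n z≤n)
tail⇒InJ (suc zero) {S} ns mult tail =
  step (base {S = S ∪≥ 0} (λ _ → inj₂ z≤n)) ns (minusZero-isIdeal-∪≥ 0 ns mult tail)
tail⇒InJ (suc (suc j)) {m = m} ns mult tail =
  step (tail⇒InJ (suc j) (∪≥-isNumericalSemigroup c ns)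
                          (∪≥-isMultiplicity (m≤m+n m (j * m)) mult) (λ _ → inj₂))
       ns (minusZero-isIdeal-∪≥ c ns mult tail)
  where
  c : ℕ
  c = suc j * m

InJ⇔frobenius< : ∀ k {S f m} → IsNumericalSemigroup S → IsFrobenius S f → IsMultiplicity S m
  → InJ k S ⇔ f < k * m
InJ⇔frobenius< k ns (f∉S , above) mult@(0<m , m∈S , _) = mk⇔
  (λ S∈J → ≰⇒> (λ km≤f → f∉S (InJ⇒tail S∈J m∈S (≢-sym (<⇒≢ 0<m)) _ km≤f)))
  (λ f<km → tail⇒InJ k ns mult (λ n km≤n → above n (<-≤-trans f<km km≤n)))

theorem21 : (S : SubsetN) → IsNumericalSemigroup S → (∃ λ n → ¬ S n)
    → (k : ℕ) → 0 < k → (f m : ℕ) → IsFrobenius S f → IsMultiplicity S m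
    → (HasComplexity S k ⇔ (((k ∸ 1) * m < f) × (f < k * m)))
theorem21 S ns _ (suc j) _ f m frob@(f∉S , _) mult@(_ , m∈S , _) = mk⇔
  (λ (S∈J , S∉lower) → ≤∧≢⇒< (≮⇒≥ (S∉lower j ≤-refl ∘ from (J⇔ j))) jm≢f , to (J⇔ (suc j)) S∈J)
  (λ (jm<f , f<km) → from (J⇔ (suc j)) f<km ,
     λ i i≤j S∈Jᵢ → <⇒≱ (to (J⇔ i) S∈Jᵢ) (≤-trans (*-monoˡ-≤ m (≤-pred i≤j)) (<⇒≤ jm<f)))
  where
  open Equivalence
  J⇔ : ∀ i → InJ i S ⇔ f < i * m
  J⇔ i = InJ⇔frobenius< i ns frob mult
  jm≢f : j * m ≢ f
  jm≢f jm≡f = f∉S (subst S jm≡f (multiple-∈ ns m∈S j))
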